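{- If the $O(\Delta)$-unique-maximum coloring problem can be solved in $O(\Delta+\log^* n)$ rounds in the $\mathsf{LOCAL}$ model on $n$-node hypergraphs of maximum degree $\Delta$, then a maximal independent set of such hypergraphs can also be computed in $O(\Delta+\log^* n)$ rounds.
   Context: A hypergraph $H=(V,E)$ has node set $V$ and hyperedges $E\subseteq 2^V$; $\Delta$ is the maximum number of hyperedges containing a node. A $c$-unique-maximum coloring assigns each node a label in $\{1,\dots,c\}$ such that for every hyperedge $e$, the maximum color used by the nodes of $e$ is used by exactly one node of $e$. An independent set is a set $S\subseteq V$ such that no hyperedge is fully contained in $S$; a maximal independent set is an inclusion-wise maximal one. In the $\mathsf{LOCAL}$ model nodes have unique IDs from $\{1,\dots,n^{c'}\}$, know their degree, $\Delta$, the rank, and $n$, and in synchronous rounds exchange unbounded messages with nodes sharing a hyperedge. -}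

module Defs where

open import Data.Nat using (ℕ; zero; suc; _+_; _*_; _^_; _≤_; _<_; _⊔_; _≤ᵇ_)
open import Data.Nat.Logarithm using (⌊log₂_⌋)
open import Data.Bool using (Bool; true; false; if_then_else_)
open import Data.Fin using (Fin)
open import Data.Fin.Subset using (Subset; _∈_; _∉_; _⊆_; _∪_; ⁅_⁆; ∣_∣; Nonempty)
open import Data.Fin.Subset.Properties using (_∈?_)
open import Data.List using (List; length; filter; map; foldr; allFin)
open import Data.List.Relation.Unary.All using (All)
open import Data.List.Relation.Unary.Unique.Propositional using (Unique)
import Data.List.Membership.Propositional as L
open import Data.Vec using (tabulate)
open import Data.Product using (Σ; ∃; ∃-syntax; _×_; _,_)
open import Relation.Binary.PropositionalEquality using (_≡_; _≢_)
open import Relation.Nullary using (¬_)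

-- Iterated logarithm log* n : number of applications of ⌊log₂⌋ needed
-- to bring n down to ≤ 1 (fuel n is always sufficient).

logStarFuel : ℕ → ℕ → ℕ
logStarFuel zero    m = zero
logStarFuel (suc f) m = if m ≤ᵇ 1 then zero else suc (logStarFuel f ⌊log₂ m ⌋)

logStar : ℕ → ℕ
logStar n = logStarFuel n n

record Hypergraph (N : ℕ) : Set where
  field
    edges    : List (Subset N)
    unique   : Unique edges
    nonempty : All Nonempty edges
open Hypergraph public

degree : ∀ {N} → Hypergraph N → Fin N → ℕ
degree H v = length (filter (λ e → v ∈? e) (edges H))

maxDeg : ∀ {N} → Hypergraph N → ℕ
maxDeg {N} H = foldr _⊔_ 0 (map (degree H) (allFin N))

rank : ∀ {N} → Hypergraph N → ℕ
rank H = foldr _⊔_ 0 (map ∣_∣ (edges H))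

UniqueMaxColoring : ∀ {N} → Hypergraph N → ℕ → (Fin N → ℕ) → Set
UniqueMaxColoring {N} H c χ =
  (∀ v → 1 ≤ χ v × χ v ≤ c) ×
  (∀ e → e L.∈ edges H → ∃[ v ] (v ∈ e × (∀ u → u ∈ e → u ≢ v → χ u < χ v)))

Independent : ∀ {N} → Hypergraph N → Subset N → Set
Independent H S = ∀ e → e L.∈ edges H → ¬ (e ⊆ S)

MaximalIndependent : ∀ {N} → Hypergraph N → Subset N → Set
MaximalIndependent H S =
  Independent H S × (∀ v → v ∉ S → ¬ Independent H (S ∪ ⁅ v ⁆))

record Instance (c' : ℕ) : Set where
  field
    N     : ℕ
    H     : Hypergraph N
    ident : Fin N → ℕ
    identInj   : ∀ u v → ident u ≡ ident v → u ≡ v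
    identBound : ∀ v → 1 ≤ ident v × ident v ≤ N ^ c'
open Instance public

Algorithm : ℕ → Set → Set
Algorithm c' O = (I : Instance c') → Fin (N I) → O

data Dist≤ {N} (H : Hypergraph N) : ℕ → Fin N → Fin N → Set where
  here : ∀ {k v} → Dist≤ H k v v
  step : ∀ {k v w u e} → e L.∈ edges H → v ∈ e → w ∈ e →
         Dist≤ H k w u → Dist≤ H (suc k) v u

Touches : ∀ {N} → Hypergraph N → ℕ → Fin N → Subset N → Set
Touches H T v e = ∃[ w ] (w ∈ e × Dist≤ H T v w)

SameIds : ∀ {c'} (I J : Instance c') → Subset (N I) → Subset (N J) → Set
SameIds I J e e' =
  (∀ x → x ∈ e → ∃[ y ] (y ∈ e' × ident I x ≡ ident J y)) ×
  (∀ y → y ∈ e' → ∃[ x ] (x ∈ e × ident I x ≡ ident J y))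

ViewIncl : ∀ {c'} → ℕ → (I : Instance c') → Fin (N I) →
           (J : Instance c') → Fin (N J) → Set
ViewIncl T I v J v' =
  ∀ e → e L.∈ edges (H I) → Touches (H I) T v e →
  ∃[ e' ] (e' L.∈ edges (H J) × Touches (H J) T v' e' × SameIds I J e e')

SameView : ∀ {c'} → ℕ → (I : Instance c') → Fin (N I) →
           (J : Instance c') → Fin (N J) → Set
SameView T I v J v' =
  ident I v ≡ ident J v' × ViewIncl T I v J v' × ViewIncl T J v' I v

-- A runs in T(n, Δ) rounds: the output of a node depends only on the
-- globally known parameters (n, Δ, rank) and its radius-T(n,Δ) view.
RunsIn : ∀ {c'} {O : Set} → (ℕ → ℕ → ℕ) → Algorithm c' O → Set
RunsIn {c'} T A =
  ∀ (I J : Instance c') (v : Fin (N I)) (v' : Fin (N J)) →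
  N I ≡ N J → maxDeg (H I) ≡ maxDeg (H J) → rank (H I) ≡ rank (H J) →
  SameView (T (N I) (maxDeg (H I))) I v J v' → A I v ≡ A J v'

IsO-Δ+log* : (ℕ → ℕ → ℕ) → ℕ → Set
IsO-Δ+log* T K = ∀ n Δ → T n Δ ≤ K * (Δ + logStar n + 1)

UMColoringFast : ℕ → Set
UMColoringFast c' =
  ∃[ C ] ∃[ K ] ∃[ T ] Σ (Algorithm c' ℕ) λ A →
    IsO-Δ+log* T K × RunsIn T A ×
    (∀ I → UniqueMaxColoring (H I) (C * (maxDeg (H I) + 1)) (A I))

MISFast : ℕ → Set
MISFast c' =
  ∃[ K ] ∃[ T ] Σ (Algorithm c' Bool) λ A →
    IsO-Δ+log* T K × RunsIn T A ×
    (∀ I → MaximalIndependent (H I) (tabulate (A I)))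

-- Process the colour classes 1, 2, …, c in order.  In phase i every node of
-- colour i joins S unless some hyperedge containing it already has all its
-- other nodes in S.  A hyperedge never ends up inside S: its unique node of
-- maximum colour joins last among its nodes, and at that moment the hyperedge
-- itself forbids it to join.  A node left out was forbidden by a hyperedge,
-- which witnesses maximality.  Phase i only inspects the current S in the
-- 1-neighbourhood, so after the colouring (T rounds) the c = O(Δ) phases take
-- c further rounds, giving T + O(Δ) = O(Δ + log* n) rounds.
module Submission where

open import Defs
open import Data.Nat using (ℕ; zero; suc; _+_; _*_; _≤_; _<_; s≤s)
open import Data.Nat.Properties
open import Data.Bool using (Bool; true; false; not; if_then_else_)
open import Data.Bool.Properties using (¬-not) renaming (_≟_ to _≟ᵇ_)
open import Data.Fin using (Fin)
import Data.Fin.Properties as Fin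
open import Data.Fin.Subset using (_∈_; _∉_; _⊆_; _∪_; ⁅_⁆)
open import Data.Fin.Subset.Properties using (_∈?_; x∈⁅x⁆; x∈p∪q⁺)
open import Data.List.Relation.Unary.Any using (Any; any?)
import Data.List.Membership.Propositional as L
open import Data.Vec using (tabulate)
open import Data.Vec.Properties using (lookup∘tabulate; []=⇒lookup; lookup⇒[]=)
open import Data.Product using (∃-syntax; _×_; _,_; proj₁; proj₂)
open import Data.Sum using (inj₁; inj₂)
open import Relation.Binary.PropositionalEquality
open import Relation.Nullary using (¬_; Dec; yes; no; does; proof; contradiction)
open import Relation.Nullary.Reflects using (Reflects; invert)
open import Relation.Nullary.Decidable using (_×-dec_; _→-dec_; ¬?; map′; dec-true; dec-false; does-≡; decidable-stable)
open import Function using (_∘_)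

does-true⇒ : ∀ {P : Set} (p? : Dec P) → does p? ≡ true → P
does-true⇒ p? eq = invert (subst (Reflects _) eq (proof p?))

does-false⇒ : ∀ {P : Set} (p? : Dec P) → does p? ≡ false → ¬ P
does-false⇒ p? eq = invert (subst (Reflects _) eq (proof p?))

∈-tabulate⁻ : ∀ {n} (f : Fin n → Bool) {u} → u ∈ tabulate f → f u ≡ true
∈-tabulate⁻ f {u} p = trans (sym (lookup∘tabulate f u)) ([]=⇒lookup p)

∈-tabulate⁺ : ∀ {n} (f : Fin n → Bool) {u} → f u ≡ true → u ∈ tabulate f
∈-tabulate⁺ f {u} p = lookup⇒[]= u (tabulate f) (trans (lookup∘tabulate f u) p)

module _ {N} {H : Hypergraph N} where

  Dist≤-mono : ∀ {a b v u} → a ≤ b → Dist≤ H a v u → Dist≤ H b v u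
  Dist≤-mono _         here              = here
  Dist≤-mono (s≤s a≤b) (step e∈ v∈ w∈ p) = step e∈ v∈ w∈ (Dist≤-mono a≤b p)

  Dist≤-snoc : ∀ {d v x w e} → Dist≤ H d v x → e L.∈ edges H → x ∈ e → w ∈ e →
               Dist≤ H (suc d) v w
  Dist≤-snoc here              e∈ x∈ w∈ = step e∈ x∈ w∈ here
  Dist≤-snoc (step a∈ b∈ c∈ p) e∈ x∈ w∈ = step a∈ b∈ c∈ (Dist≤-snoc p e∈ x∈ w∈)

  Dist≤-trans : ∀ {a b v x u} → Dist≤ H a v x → Dist≤ H b x u → Dist≤ H (a + b) v u
  Dist≤-trans {a} {b} here q = Dist≤-mono (m≤n+m b a) q
  Dist≤-trans (step e∈ v∈ w∈ p) q = step e∈ v∈ w∈ (Dist≤-trans p q)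

module _ {c' : ℕ} where

  -- A path of length k starting at distance d from v stays inside the
  -- radius-R view when d + k ≤ R, so it can be copied hyperedge by hyperedge.
  lift-path : (I J : Instance c') → ∀ {R v v'} → ViewIncl R I v J v' →
              ∀ {k x u d} → Dist≤ (H I) k x u → Dist≤ (H I) d v x → d + k ≤ R →
              ∀ x' → ident I x ≡ ident J x' →
              ∃[ u' ] (ident I u ≡ ident J u' × Dist≤ (H J) k x' u')
  lift-path I J view here _ _ x' x≈x' = x' , x≈x' , here
  lift-path I J {R} view {d = d} (step {k} {x} {w} {u} {e} e∈ x∈ w∈ rest) vx d+k<R x' x≈x' =
    let e' , e'∈ , _ , (e⊆e' , _) = view e e∈ (x , x∈ , Dist≤-mono (≤-trans (m≤m+n d (suc k)) d+k<R) vx)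
        y , y∈ , x≈y = e⊆e' x x∈
        w' , w'∈ , w≈w' = e⊆e' w w∈
        d+1+k≤R = subst (_≤ R) (+-suc d k) d+k<R
        u' , u≈u' , w'u' = lift-path I J view rest (Dist≤-snoc vx e∈ x∈ w∈) d+1+k≤R w' w≈w'
        x'∈e' = subst (_∈ e') (identInj J y x' (trans (sym x≈y) x≈x')) y∈
    in u' , u≈u' , step e'∈ x'∈e' w'∈ w'u'

  ViewIncl-recenter : (I J : Instance c') → ∀ {R r d v v' u u'} → ViewIncl R I v J v' →
                      Dist≤ (H I) d v u → ident I u ≡ ident J u' → d + r ≤ R →
                      ViewIncl r I u J u'
  ViewIncl-recenter I J {r = r} {u' = u'} view vu u≈u' d+r≤R f f∈ (w , w∈ , uw) =
    let f' , f'∈ , _ , same = view f f∈ (w , w∈ , Dist≤-mono d+r≤R (Dist≤-trans vu uw))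
        w' , w'∈ , w≈w' = proj₁ same w w∈
        w″ , w≈w″ , u'w″ = lift-path I J view uw vu d+r≤R u' u≈u'
        w'≡w″ = identInj J w' w″ (trans (sym w≈w') w≈w″)
    in f' , f'∈ , (w' , w'∈ , subst (Dist≤ (H J) r u') (sym w'≡w″) u'w″) , same

  SameView-recenter : (I J : Instance c') → ∀ {R r d v v' u u'} → SameView R I v J v' →
                      Dist≤ (H I) d v u → Dist≤ (H J) d v' u' → ident I u ≡ ident J u' →
                      d + r ≤ R → SameView r I u J u'
  SameView-recenter I J (_ , I⊆J , J⊆I) vu v'u' u≈u' d+r≤R =
    u≈u' , ViewIncl-recenter I J I⊆J vu u≈u' d+r≤R , ViewIncl-recenter J I J⊆I v'u' (sym u≈u') d+r≤R

  SameView-shrink : (I J : Instance c') → ∀ {R r v v'} → r ≤ R →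
                    SameView R I v J v' → SameView r I v J v'
  SameView-shrink I J r≤R view = SameView-recenter I J view here here (proj₁ view) r≤R

  SameView-sym : (I J : Instance c') → ∀ {R v v'} → SameView R I v J v' → SameView R J v' I v
  SameView-sym I J (v≈v' , I⊆J , J⊆I) = sym v≈v' , J⊆I , I⊆J

Rejected : ∀ {N} → Hypergraph N → (Fin N → Bool) → Fin N → Set
Rejected H S v = Any (λ e → v ∈ e × (∀ u → u ∈ e → u ≢ v → S u ≡ true)) (edges H)

rejected? : ∀ {N} (H : Hypergraph N) (S : Fin N → Bool) (v : Fin N) → Dec (Rejected H S v)
rejected? H S v =
  any? (λ e → (v ∈? e) ×-dec Fin.all? (λ u → (u ∈? e) →-dec (¬? (u Fin.≟ v) →-dec (S u ≟ᵇ true))))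
       (edges H)

-- Phase i overwrites only the entries of colour i, which are still false
-- before it, so this is the union of S_{i-1} with the joining nodes.
greedy : ∀ {N} → Hypergraph N → (Fin N → ℕ) → ℕ → Fin N → Bool
greedy H χ zero    v = false
greedy H χ (suc i) v =
  if does (χ v ≟ suc i) then does (¬? (rejected? H (greedy H χ i) v)) else greedy H χ i v

module Greedy {N} (H : Hypergraph N) (χ : Fin N → ℕ) where

  S : ℕ → Fin N → Bool
  S = greedy H χ

  S-other : ∀ i v → χ v ≢ suc i → S (suc i) v ≡ S i v
  S-other i v χv≢ rewrite dec-false (χ v ≟ suc i) χv≢ = refl

  S-own : ∀ i v → χ v ≡ suc i → S (suc i) v ≡ does (¬? (rejected? H (S i) v))
  S-own i v χv≡ rewrite dec-true (χ v ≟ suc i) χv≡ = refl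

  S-before : ∀ i v → i < χ v → S i v ≡ false
  S-before zero    v _     = refl
  S-before (suc i) v 1+i<χ =
    trans (S-other i v (≢-sym (<⇒≢ 1+i<χ))) (S-before i v (<-trans (n<1+n i) 1+i<χ))

  S-after : ∀ k v → S (χ v + k) v ≡ S (χ v) v
  S-after zero    v = cong (λ i → S i v) (+-identityʳ (χ v))
  S-after (suc k) v = begin
    S (χ v + suc k) v   ≡⟨ cong (λ i → S i v) (+-suc (χ v) k) ⟩
    S (suc (χ v + k)) v ≡⟨ S-other (χ v + k) v (<⇒≢ (s≤s (m≤m+n (χ v) k))) ⟩
    S (χ v + k) v       ≡⟨ S-after k v ⟩
    S (χ v) v           ∎
    where open ≡-Reasoning

  S-settled : ∀ {i k} v → χ v ≤ i → χ v ≤ k → S i v ≡ S k v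
  S-settled v χ≤i χ≤k with i , refl ← m≤n⇒∃[o]m+o≡n χ≤i | k , refl ← m≤n⇒∃[o]m+o≡n χ≤k =
    trans (S-after i v) (sym (S-after k v))

  S⇒χ≤ : ∀ i v → S i v ≡ true → χ v ≤ i
  S⇒χ≤ i v v∈S = ≮⇒≥ (λ i<χ → contradiction (trans (sym v∈S) (S-before i v i<χ)) λ ())

  S-decided : ∀ {i j} v → χ v ≡ suc j → χ v ≤ i → S i v ≡ does (¬? (rejected? H (S j) v))
  S-decided {i} {j} v χv≡ χ≤i = begin
    S i v                           ≡⟨ S-settled v χ≤i ≤-refl ⟩
    S (χ v) v                       ≡⟨ cong (λ k → S k v) χv≡ ⟩
    S (suc j) v                     ≡⟨ S-own j v χv≡ ⟩
    does (¬? (rejected? H (S j) v)) ∎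
    where open ≡-Reasoning

  S-joined : ∀ i {j} v → χ v ≡ suc j → S i v ≡ true → ¬ Rejected H (S j) v
  S-joined i {j} v χv≡ v∈S =
    does-true⇒ (¬? (rejected? H (S j) v)) (trans (sym (S-decided v χv≡ (S⇒χ≤ i v v∈S))) v∈S)

  S-rejected : ∀ i {j} v → χ v ≡ suc j → χ v ≤ i → S i v ≡ false → Rejected H (S j) v
  S-rejected i {j} v χv≡ χ≤i v∉S =
    decidable-stable (rejected? H (S j) v)
      (does-false⇒ (¬? (rejected? H (S j) v)) (trans (sym (S-decided v χv≡ χ≤i)) v∉S))

  module _ (positive : ∀ v → 1 ≤ χ v) where

    private
      pred-colour : ∀ v → ∃[ j ] (χ v ≡ suc j)
      pred-colour v = let j , 1+j≡χ = m≤n⇒∃[o]m+o≡n (positive v) in j , sym 1+j≡χ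

    S-independent : (∀ e → e L.∈ edges H → ∃[ m ] (m ∈ e × (∀ u → u ∈ e → u ≢ m → χ u < χ m))) →
                    ∀ i → Independent H (tabulate (S i))
    S-independent unique-max i e e∈ e⊆S =
      S-joined i m χm≡ (∈-tabulate⁻ (S i) (e⊆S m∈)) (L.lose e∈ (m∈ , others-in-S))
      where
      m = proj₁ (unique-max e e∈)
      m∈ = proj₁ (proj₂ (unique-max e e∈))
      j = proj₁ (pred-colour m)
      χm≡ = proj₂ (pred-colour m)
      others-in-S : ∀ u → u ∈ e → u ≢ m → S j u ≡ true
      others-in-S u u∈ u≢m = trans (S-settled u χu≤j (S⇒χ≤ i u u∈S)) u∈S
        where
        u∈S = ∈-tabulate⁻ (S i) (e⊆S u∈)
        χu≤j = ≤-pred (subst (χ u <_) χm≡ (proj₂ (proj₂ (unique-max e e∈)) u u∈ u≢m))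

    S-maximal : ∀ c → (∀ v → χ v ≤ c) →
                ∀ v → v ∉ tabulate (S c) → ¬ Independent H (tabulate (S c) ∪ ⁅ v ⁆)
    S-maximal c bounded v v∉S independent = independent e e∈ e⊆S∪v
      where
      j = proj₁ (pred-colour v)
      v-rejected = S-rejected c v (proj₂ (pred-colour v)) (bounded v) (¬-not (v∉S ∘ ∈-tabulate⁺ (S c)))
      e = proj₁ (L.find v-rejected)
      e∈ = proj₁ (proj₂ (L.find v-rejected))
      others-in-S = proj₂ (proj₂ (proj₂ (L.find v-rejected)))
      e⊆S∪v : e ⊆ tabulate (S c) ∪ ⁅ v ⁆
      e⊆S∪v {u} u∈e with u Fin.≟ v
      ... | yes refl = x∈p∪q⁺ (inj₂ (x∈⁅x⁆ u))
      ... | no u≢v   = x∈p∪q⁺ (inj₁ (∈-tabulate⁺ (S c)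
                         (trans (S-settled u (bounded u) (S⇒χ≤ j u u∈S)) u∈S)))
        where u∈S = others-in-S u u∈e u≢v

greedy-maximalIndependent : ∀ {N} (H : Hypergraph N) c (χ : Fin N → ℕ) →
                            UniqueMaxColoring H c χ → MaximalIndependent H (tabulate (greedy H χ c))
greedy-maximalIndependent H c χ (in-range , unique-max) =
  S-independent positive unique-max c , S-maximal positive c (proj₂ ∘ in-range)
  where
  open Greedy H χ
  positive = proj₁ ∘ in-range

module _ {c' : ℕ} (I J : Instance c') where

  Rejected-transport : ∀ (SI : Fin (N I) → Bool) (SJ : Fin (N J) → Bool) R →
                       (∀ u u' → SameView R I u J u' → SI u ≡ SJ u') →
                       ∀ {v v'} → SameView (suc R) I v J v' → Rejected (H I) SI v → Rejected (H J) SJ v'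
  Rejected-transport SI SJ R S-local {v} {v'} view rejected =
    L.lose e'∈ (v'∈e' , others-in-SJ)
    where
    e = proj₁ (L.find rejected)
    e∈ = proj₁ (proj₂ (L.find rejected))
    v∈e = proj₁ (proj₂ (proj₂ (L.find rejected)))
    others-in-SI = proj₂ (proj₂ (proj₂ (L.find rejected)))
    image = proj₁ (proj₂ view) e e∈ (v , v∈e , here)
    e' = proj₁ image
    e'∈ = proj₁ (proj₂ image)
    same = proj₂ (proj₂ (proj₂ image))
    v'∈e' : v' ∈ e'
    v'∈e' with y , y∈ , v≈y ← proj₁ same v v∈e =
      subst (_∈ e') (identInj J y v' (trans (sym v≈y) (proj₁ view))) y∈
    others-in-SJ : ∀ u' → u' ∈ e' → u' ≢ v' → SJ u' ≡ true
    others-in-SJ u' u'∈ u'≢v' with u , u∈ , u≈u' ← proj₂ same u' u'∈ =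
      trans (sym (S-local u u' view-u)) (others-in-SI u u∈ u≢v)
      where
      u≢v : u ≢ v
      u≢v u≡v = u'≢v' (identInj J u' v' (trans (sym u≈u') (trans (cong (ident I) u≡v) (proj₁ view))))
      view-u = SameView-recenter I J view (step e∈ v∈e u∈ here) (step e'∈ v'∈e' u'∈ here) u≈u' ≤-refl

module _ {c' : ℕ} (I J : Instance c') (χI : Fin (N I) → ℕ) (χJ : Fin (N J) → ℕ) (T : ℕ)
         (χ-local : ∀ u u' → SameView T I u J u' → χI u ≡ χJ u') where

  greedy-local : ∀ i v v' → SameView (T + i) I v J v' → greedy (H I) χI i v ≡ greedy (H J) χJ i v'
  greedy-local zero    v v' view = refl
  greedy-local (suc i) v v' view
    rewrite χ-local v v' (SameView-shrink I J (m≤m+n T (suc i)) view) =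
    cong₂ (if_then_else_ (does (χJ v' ≟ suc i))) (cong not rejected-same)
          (greedy-local i v v' (SameView-shrink I J (+-monoʳ-≤ T (n≤1+n i)) view))
    where
    SI = greedy (H I) χI i
    SJ = greedy (H J) χJ i
    view′ : SameView (suc (T + i)) I v J v'
    view′ = subst (λ r → SameView r I v J v') (+-suc T i) view
    rejected-same : does (rejected? (H I) SI v) ≡ does (rejected? (H J) SJ v')
    rejected-same =
      does-≡ (map′ (Rejected-transport I J SI SJ (T + i) (greedy-local i) view′)
                   (Rejected-transport J I SJ SI (T + i)
                      (λ u' u view-u → sym (greedy-local i u u' (SameView-sym J I view-u)))
                      (SameView-sym I J view′))
                   (rejected? (H I) SI v))
             (rejected? (H J) SJ v')

IsO-Δ+log*-+-linear : ∀ {T K} C → IsO-Δ+log* T K → IsO-Δ+log* (λ n Δ → T n Δ + C * (Δ + 1)) (K + C)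
IsO-Δ+log*-+-linear {T} {K} C T≤ n Δ = begin
  T n Δ + C * (Δ + 1)
    ≤⟨ +-mono-≤ (T≤ n Δ) (*-monoʳ-≤ C (+-monoˡ-≤ 1 (m≤m+n Δ (logStar n)))) ⟩
  K * (Δ + logStar n + 1) + C * (Δ + logStar n + 1)
    ≡⟨ *-distribʳ-+ (Δ + logStar n + 1) K C ⟨
  (K + C) * (Δ + logStar n + 1)
    ∎
  where open ≤-Reasoning

theorem37 : (c' : ℕ) → UMColoringFast c' → MISFast c'
theorem37 c' (C , K , T , A , T-fast , A-local , A-colours) =
  K + C , T′ , MIS , IsO-Δ+log*-+-linear {K = K} C T-fast , MIS-local , MIS-correct
  where
  colours : ∀ {N} → Hypergraph N → ℕ
  colours H = C * (maxDeg H + 1)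
  T′ : ℕ → ℕ → ℕ
  T′ n Δ = T n Δ + C * (Δ + 1)
  MIS : Algorithm c' Bool
  MIS I = greedy (H I) (A I) (colours (H I))
  MIS-local : RunsIn T′ MIS
  MIS-local I J v v' eN eΔ eR view =
    trans (greedy-local I J (A I) (A J) (T (N I) (maxDeg (H I))) (λ u u' → A-local I J u u' eN eΔ eR) _ v v' view)
          (cong (λ Δ → greedy (H J) (A J) (C * (Δ + 1)) v') eΔ)
  MIS-correct : ∀ I → MaximalIndependent (H I) (tabulate (MIS I))
  MIS-correct I = greedy-maximalIndependent (H I) (colours (H I)) (A I) (A-colours I)
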